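{- Let $\alpha_1, \alpha_2, \tau \geq 0$. Let $\mathcal{H}$ be an $n$-vertex linear hypergraph in which every edge $e$ satisfies $|e| \geq 1 + \alpha_2$. Let $e \in \mathcal{H}$, let $r := |e|$, let $m_1 := |\{f \in N(e) : |f| \geq (1+\alpha_1)r\}|$ and $m_2 := |\{f \in N(e) : (1+\alpha_1)r > |f| \geq r/(1+\alpha_2)\}|$. If $r > 1 + \alpha_2$, then (i) $(1+\alpha_1)m_1 + \frac{m_2}{1+\alpha_2} \leq n + \frac{(1+\alpha_2)n}{r - 1 - \alpha_2}$. Moreover, if $m_1 + m_2 \geq (1-\tau)n$ and $\alpha_1 > 0$, then (ii) $m_1 \leq \left(\tau + \frac{(1+\alpha_2)(1+\alpha_2 r)}{r-1-\alpha_2}\right)\frac{n}{\alpha_1}$.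
   Context: A hypergraph has a finite vertex set and a set of (non-repeated) nonempty subsets as edges; it is linear if distinct edges share at most one vertex. For an edge $e$, $N(e)$ is the set of edges $f \ne e$ with $f \cap e \ne \varnothing$.
   Formalization: The parameters α₁, α₂, τ range over the nonnegative rationals. -}

module Defs where

open import Data.Nat using (ℕ; _≤_)
open import Data.Bool using (Bool)
import Data.Bool.Properties as BoolP
open import Data.Integer using (+_)
open import Data.Rational using (ℚ; 0ℚ; _/_; _÷_; ≢-nonZero)
open import Data.Rational.Properties using (_≟_)
open import Data.Fin.Subset using (Subset; _∩_; ⊥; ∣_∣)
open import Data.Vec.Properties using (≡-dec)
open import Data.List using (List; filter; length)
open import Data.List.Membership.Propositional using (_∈_)
open import Data.List.Relation.Unary.All using (All)
open import Data.List.Relation.Unary.Unique.Propositional using (Unique)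
open import Data.Product using (_×_; ∃)
open import Relation.Binary.PropositionalEquality using (_≡_; _≢_)
open import Relation.Nullary using (Dec; yes; no; ¬?; _×-dec_)

_≟ˢ_ : ∀ {n} (p q : Subset n) → Dec (p ≡ q)
_≟ˢ_ = ≡-dec BoolP._≟_

record Hypergraph (n : ℕ) : Set where
  field
    edges    : List (Subset n)
    distinct : Unique edges
    nonempty : All (λ e → e ≢ ⊥) edges
open Hypergraph public

Linear : ∀ {n} → Hypergraph n → Set
Linear H = ∀ {e f} → e ∈ edges H → f ∈ edges H → e ≢ f → ∣ e ∩ f ∣ ≤ 1

N : ∀ {n} → Hypergraph n → Subset n → List (Subset n)
N H e = filter (λ f → ¬? (f ≟ˢ e) ×-dec ¬? ((f ∩ e) ≟ˢ ⊥)) (edges H)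

ℕ→ℚ : ℕ → ℚ
ℕ→ℚ k = (+ k) / 1

sz : ∀ {n} → Subset n → ℚ
sz e = ℕ→ℚ ∣ e ∣

-- total division (x / 0 := 0); only ever applied to positive denominators
_÷ᵗ_ : ℚ → ℚ → ℚ
p ÷ᵗ q with q ≟ 0ℚ
... | yes _  = 0ℚ
... | no q≢0 = _÷_ p q {{≢-nonZero q≢0}}

{-# OPTIONS --safe #-}
module Submission where

-- Every f ∈ N(e) meets e in exactly one vertex, so |f| - 1 = |f ─ e|. Count the pairs (u, v) with
-- u ∈ f ─ e and v ∈ f ∩ e over all f ∈ N(e): by linearity two distinct vertices lie in at most one
-- common edge, so there are at most n·r of them, i.e. Σ_{f ∈ N(e)} (|f| - 1) ≤ n·r. An edge counted
-- by m₁ contributes at least (1 + α₁)(r - 1 - α₂) to this sum and one counted by m₂ at least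
-- r/(1 + α₂) - 1 = (r - 1 - α₂)/(1 + α₂); dividing by r - 1 - α₂ gives (i). For (ii), write
-- m₂/(1 + α₂) = m₂ - α₂·m₂/(1 + α₂), use m₁ + m₂ ≥ (1 - τ)n, and bound m₂/(1 + α₂) once more by (i).

open import Defs

module LinearHypergraph where
  open import Data.Nat using (ℕ; zero; suc; _+_; _*_; _≤_; _<_; z≤n; s≤s)
  open import Data.Nat.Properties
  open import Data.Nat.ListAction using (sum)
  open import Data.Bool using (Bool; true; false; _∧_; not; if_then_else_)
  open import Data.Bool.Properties using (∧-zeroʳ; ∧-identityʳ; ∧-comm; ∧-conicalˡ; ∧-conicalʳ)
  open import Data.Fin using (Fin; zero; suc)
  open import Data.Vec using ([]; _∷_; lookup)
  open import Data.Vec.Properties using (lookup-zipWith; lookup⇒[]=)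
  open import Data.Fin.Subset as Subset using (Subset; _∩_; _─_; _-_; ⊥; ∣_∣)
  open import Data.Fin.Subset.Properties using (x∈p⇒∣p-x∣<∣p∣; x∈p∧x≢y⇒x∈p-y; x∈p∩q⁺; Empty-unique)
  open import Data.List using (List; []; _∷_; map)
  open import Data.List.Properties using (map-cong; map-cong-local)
  open import Data.List.Membership.Propositional using (_∈_)
  open import Data.List.Membership.Propositional.Properties using (∈-filter⁻)
  open import Data.List.Relation.Unary.Any using (here; there)
  import Data.List.Relation.Unary.All as All
  open import Data.List.Relation.Unary.AllPairs using ([]; _∷_)
  open import Data.List.Relation.Unary.Unique.Propositional using (Unique)
  import Data.List.Relation.Unary.Unique.Propositional.Properties as Unique
  open import Data.Product using (_×_; _,_; proj₁)
  open import Algebra.Properties.Semiring.Sum +-*-semiring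
    using (sum-syntax; ∑-distrib-+; *-distribˡ-sum; *-distribʳ-sum; sum-cong-≗)
  open import Function using (_∘_)
  open import Relation.Binary.PropositionalEquality
  open import Relation.Nullary using (Dec; yes; no; contradiction; ¬?; _×-dec_)

  toℕ : Bool → ℕ
  toℕ b = if b then 1 else 0

  ∑-const : ∀ n c → ∑[ i < n ] c ≡ n * c
  ∑-const zero    c = refl
  ∑-const (suc n) c = cong (c +_) (∑-const n c)

  ∑-mono-≤ : ∀ {n} {g h : Fin n → ℕ} → (∀ i → g i ≤ h i) → ∑[ i < n ] g i ≤ ∑[ i < n ] h i
  ∑-mono-≤ {zero}  _   = z≤n
  ∑-mono-≤ {suc n} g≤h = +-mono-≤ (g≤h zero) (∑-mono-≤ (g≤h ∘ suc))

  sum-map-∑ : ∀ {A : Set} {n} (g : A → Fin n → ℕ) (xs : List A) →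
    sum (map (λ x → ∑[ i < n ] g x i) xs) ≡ ∑[ i < n ] sum (map (λ x → g x i) xs)
  sum-map-∑ {n = n} g []       = sym (trans (∑-const n 0) (*-zeroʳ n))
  sum-map-∑         g (x ∷ xs) = trans (cong (_ +_) (sum-map-∑ g xs)) (sym (∑-distrib-+ (g x) _))

  sum-map-toℕ≡0 : ∀ {A : Set} (p : A → Bool) {xs : List A} →
    (∀ {x} → x ∈ xs → p x ≡ false) → sum (map (toℕ ∘ p) xs) ≡ 0
  sum-map-toℕ≡0 p {[]}     _     = refl
  sum-map-toℕ≡0 p {x ∷ xs} p≡false rewrite p≡false (here refl) = sum-map-toℕ≡0 p (p≡false ∘ there)

  sum-map-toℕ≤1 : ∀ {A : Set} (p : A → Bool) {xs : List A} → Unique xs →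
    (∀ {x y} → x ∈ xs → y ∈ xs → p x ≡ true → p y ≡ true → x ≡ y) →
    sum (map (toℕ ∘ p) xs) ≤ 1
  sum-map-toℕ≤1 p {[]}     []             _   = z≤n
  sum-map-toℕ≤1 p {x ∷ xs} (x≢xs ∷ !xs) one with p x in px
  ... | false = sum-map-toℕ≤1 p !xs λ x∈ y∈ → one (there x∈) (there y∈)
  ... | true  = ≤-reflexive (cong suc (sum-map-toℕ≡0 p rest-false))
    where
    rest-false : ∀ {y} → y ∈ xs → p y ≡ false
    rest-false {y} y∈ with p y in py
    ... | false = refl
    ... | true  = contradiction (one (here refl) (there y∈) px py) (All.lookup x≢xs y∈)

  ∣p∣≡∑ : ∀ {n} (p : Subset n) → ∣ p ∣ ≡ ∑[ i < n ] toℕ (lookup p i)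
  ∣p∣≡∑ []          = refl
  ∣p∣≡∑ (true ∷ p)  = cong suc (∣p∣≡∑ p)
  ∣p∣≡∑ (false ∷ p) = ∣p∣≡∑ p

  toℕ-∧ : ∀ a b → toℕ (a ∧ b) ≡ toℕ a * toℕ b
  toℕ-∧ false b = refl
  toℕ-∧ true  b = sym (+-identityʳ (toℕ b))

  ∣p∣*∣q∣≡∑∑ : ∀ {n} (p q : Subset n) →
    ∣ p ∣ * ∣ q ∣ ≡ ∑[ u < n ] ∑[ v < n ] toℕ (lookup p u ∧ lookup q v)
  ∣p∣*∣q∣≡∑∑ {n} p q = begin
    ∣ p ∣ * ∣ q ∣
      ≡⟨ cong₂ _*_ (∣p∣≡∑ p) (∣p∣≡∑ q) ⟩
    (∑[ u < n ] toℕ (lookup p u)) * (∑[ v < n ] toℕ (lookup q v))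
      ≡⟨ *-distribʳ-sum (∑[ v < n ] toℕ (lookup q v)) (toℕ ∘ lookup p) ⟩
    ∑[ u < n ] (toℕ (lookup p u) * (∑[ v < n ] toℕ (lookup q v)))
      ≡⟨ sum-cong-≗ (λ u → *-distribˡ-sum (toℕ (lookup p u)) (toℕ ∘ lookup q)) ⟩
    ∑[ u < n ] ∑[ v < n ] (toℕ (lookup p u) * toℕ (lookup q v))
      ≡⟨ sum-cong-≗ (λ u → sum-cong-≗ (λ v → sym (toℕ-∧ (lookup p u) (lookup q v)))) ⟩
    ∑[ u < n ] ∑[ v < n ] toℕ (lookup p u ∧ lookup q v) ∎
    where open ≡-Reasoning

  ∣p∣≡∣p─q∣+∣p∩q∣ : ∀ {n} (p q : Subset n) → ∣ p ∣ ≡ ∣ p ─ q ∣ + ∣ p ∩ q ∣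
  ∣p∣≡∣p─q∣+∣p∩q∣ []          []          = refl
  ∣p∣≡∣p─q∣+∣p∩q∣ (true ∷ p)  (true ∷ q)  = trans (cong suc (∣p∣≡∣p─q∣+∣p∩q∣ p q)) (sym (+-suc _ _))
  ∣p∣≡∣p─q∣+∣p∩q∣ (true ∷ p)  (false ∷ q) = cong suc (∣p∣≡∣p─q∣+∣p∩q∣ p q)
  ∣p∣≡∣p─q∣+∣p∩q∣ (false ∷ p) (true ∷ q)  = ∣p∣≡∣p─q∣+∣p∩q∣ p q
  ∣p∣≡∣p─q∣+∣p∩q∣ (false ∷ p) (false ∷ q) = ∣p∣≡∣p─q∣+∣p∩q∣ p q

  ∣p∣≡0⇒p≡⊥ : ∀ {n} {p : Subset n} → ∣ p ∣ ≡ 0 → p ≡ ⊥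
  ∣p∣≡0⇒p≡⊥ {p = p} ∣p∣≡0 =
    Empty-unique λ (x , x∈p) → n≮0 (subst (∣ p - x ∣ <_) ∣p∣≡0 (x∈p⇒∣p-x∣<∣p∣ x∈p))

  x∈p∧y∈p∧x≢y⇒2≤∣p∣ : ∀ {n} {p : Subset n} {x y} → x Subset.∈ p → y Subset.∈ p → x ≢ y → 2 ≤ ∣ p ∣
  x∈p∧y∈p∧x≢y⇒2≤∣p∣ x∈p y∈p x≢y =
    ≤-trans (s≤s (≤-trans (s≤s z≤n) (x∈p⇒∣p-x∣<∣p∣ (x∈p∧x≢y⇒x∈p-y y∈p (x≢y ∘ sym)))))
            (x∈p⇒∣p-x∣<∣p∣ x∈p)

  lookup-─ : ∀ {n} (p q : Subset n) i → lookup (p ─ q) i ≡ lookup p i ∧ not (lookup q i)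
  lookup-─ (x ∷ p) (true ∷ q)  zero    = sym (∧-zeroʳ x)
  lookup-─ (x ∷ p) (false ∷ q) zero    = sym (∧-identityʳ x)
  lookup-─ (_ ∷ p) (_ ∷ q)     (suc i) = lookup-─ p q i

  ∧-rearrange : ∀ a b c d → (a ∧ not b) ∧ (c ∧ d) ≡ (d ∧ not b) ∧ (a ∧ c)
  ∧-rearrange false b     c d = sym (∧-zeroʳ _)
  ∧-rearrange true  true  c d = cong (_∧ c) (sym (∧-zeroʳ d))
  ∧-rearrange true  false c d = trans (∧-comm c d) (cong (_∧ c) (sym (∧-identityʳ d)))

  module _ {n} (H : Hypergraph n) (linear : Linear H) where

    edge-through-pair-unique : ∀ {f g u v} → f ∈ edges H → g ∈ edges H → u ≢ v →
      lookup f u ∧ lookup f v ≡ true → lookup g u ∧ lookup g v ≡ true → f ≡ g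
    edge-through-pair-unique {f} {g} {u} {v} f∈H g∈H u≢v uv∈f uv∈g with f ≟ˢ g
    ... | yes f≡g = f≡g
    ... | no  f≢g = contradiction (linear f∈H g∈H f≢g) (<⇒≱ (x∈p∧y∈p∧x≢y⇒2≤∣p∣ u∈f∩g v∈f∩g u≢v))
      where
      u∈f∩g : u Subset.∈ f ∩ g
      u∈f∩g = x∈p∩q⁺ (lookup⇒[]= u f (∧-conicalˡ _ _ uv∈f) , lookup⇒[]= u g (∧-conicalˡ _ _ uv∈g))
      v∈f∩g : v Subset.∈ f ∩ g
      v∈f∩g = x∈p∩q⁺ (lookup⇒[]= v f (∧-conicalʳ _ _ uv∈f) , lookup⇒[]= v g (∧-conicalʳ _ _ uv∈g))

    pair-degree≤1 : ∀ {xs} → Unique xs → (∀ {f} → f ∈ xs → f ∈ edges H) → ∀ {u v} → u ≢ v →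
      sum (map (λ f → toℕ (lookup f u ∧ lookup f v)) xs) ≤ 1
    pair-degree≤1 !xs xs⊆H u≢v =
      sum-map-toℕ≤1 _ !xs λ f∈ g∈ → edge-through-pair-unique (xs⊆H f∈) (xs⊆H g∈) u≢v

    module _ {e} (e∈H : e ∈ edges H) where

      private
        meets? : (f : Subset n) → Dec (f ≢ e × f ∩ e ≢ ⊥)
        meets? f = ¬? (f ≟ˢ e) ×-dec ¬? ((f ∩ e) ≟ˢ ⊥)

      N-unique : Unique (N H e)
      N-unique = Unique.filter⁺ meets? (distinct H)

      N⊆edges : ∀ {f} → f ∈ N H e → f ∈ edges H
      N⊆edges = proj₁ ∘ ∈-filter⁻ meets?

      ∣f∩e∣≡1 : ∀ {f} → f ∈ N H e → ∣ f ∩ e ∣ ≡ 1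
      ∣f∩e∣≡1 f∈N with ∈-filter⁻ meets? f∈N
      ... | f∈H , f≢e , f∩e≢⊥ = ≤-antisym (linear f∈H e∈H f≢e) (n≢0⇒n>0 (f∩e≢⊥ ∘ ∣p∣≡0⇒p≡⊥))

      ∣f∣≡∣f─e∣+1 : ∀ {f} → f ∈ N H e → ∣ f ∣ ≡ ∣ f ─ e ∣ + 1
      ∣f∣≡∣f─e∣+1 {f} f∈N = trans (∣p∣≡∣p─q∣+∣p∩q∣ f e) (cong (∣ f ─ e ∣ +_) (∣f∩e∣≡1 f∈N))

      crossing-pairs≤ : ∀ u v →
        sum (map (λ f → toℕ (lookup (f ─ e) u ∧ lookup (f ∩ e) v)) (N H e)) ≤ toℕ (lookup e v)
      crossing-pairs≤ u v = begin
        sum (map (λ f → toℕ (lookup (f ─ e) u ∧ lookup (f ∩ e) v)) (N H e))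
          ≡⟨ cong sum (map-cong (cong toℕ ∘ rearranged) (N H e)) ⟩
        sum (map (λ f → toℕ ((lookup e v ∧ not (lookup e u)) ∧ (lookup f u ∧ lookup f v))) (N H e))
          ≤⟨ bound (lookup e v) (lookup e u) refl refl ⟩
        toℕ (lookup e v) ∎
        where
        open ≤-Reasoning
        rearranged : ∀ f → lookup (f ─ e) u ∧ lookup (f ∩ e) v
                         ≡ (lookup e v ∧ not (lookup e u)) ∧ (lookup f u ∧ lookup f v)
        rearranged f = trans (cong₂ _∧_ (lookup-─ f e u) (lookup-zipWith _∧_ v f e))
                             (∧-rearrange (lookup f u) (lookup e u) (lookup f v) (lookup e v))
        none : sum (map (λ _ → 0) (N H e)) ≡ 0
        none = sum-map-toℕ≡0 (λ _ → false) {N H e} (λ _ → refl)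
        bound : ∀ a b → lookup e v ≡ a → lookup e u ≡ b →
          sum (map (λ f → toℕ ((a ∧ not b) ∧ (lookup f u ∧ lookup f v))) (N H e)) ≤ toℕ a
        bound false _     _  _  = ≤-reflexive none
        bound true  true  _  _  = ≤-trans (≤-reflexive none) z≤n
        bound true  false ev eu = pair-degree≤1 N-unique N⊆edges λ u≡v →
          contradiction (trans (sym eu) (trans (cong (lookup e) u≡v) ev)) λ ()

      sum-excess≤∣e∣*n : sum (map (λ f → ∣ f ─ e ∣) (N H e)) ≤ ∣ e ∣ * n
      sum-excess≤∣e∣*n = begin
        sum (map (λ f → ∣ f ─ e ∣) (N H e))
          ≡⟨ cong sum (map-cong-local (All.tabulate λ {f} f∈N →
               trans (sym (*-identityʳ _)) (cong (∣ f ─ e ∣ *_) (sym (∣f∩e∣≡1 f∈N))))) ⟩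
        sum (map (λ f → ∣ f ─ e ∣ * ∣ f ∩ e ∣) (N H e))
          ≡⟨ cong sum (map-cong (λ f → ∣p∣*∣q∣≡∑∑ (f ─ e) (f ∩ e)) (N H e)) ⟩
        sum (map (λ f → ∑[ u < n ] ∑[ v < n ] crossing f u v) (N H e))
          ≡⟨ sum-map-∑ (λ f u → ∑[ v < n ] crossing f u v) (N H e) ⟩
        ∑[ u < n ] sum (map (λ f → ∑[ v < n ] crossing f u v) (N H e))
          ≡⟨ sum-cong-≗ (λ u → sum-map-∑ (λ f v → crossing f u v) (N H e)) ⟩
        ∑[ u < n ] ∑[ v < n ] sum (map (λ f → crossing f u v) (N H e))
          ≤⟨ ∑-mono-≤ (λ u → ∑-mono-≤ (crossing-pairs≤ u)) ⟩
        ∑[ u < n ] ∑[ v < n ] toℕ (lookup e v)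
          ≡⟨ sum-cong-≗ {n} (λ _ → sym (∣p∣≡∑ e)) ⟩
        ∑[ u < n ] ∣ e ∣
          ≡⟨ ∑-const n ∣ e ∣ ⟩
        n * ∣ e ∣
          ≡⟨ *-comm n ∣ e ∣ ⟩
        ∣ e ∣ * n ∎
        where
        open ≤-Reasoning
        crossing : Subset n → Fin n → Fin n → ℕ
        crossing f u v = toℕ (lookup (f ─ e) u ∧ lookup (f ∩ e) v)

open import Data.Nat as ℕ using (ℕ; z≤n)
open import Data.Nat.ListAction using (sum)
open import Data.Nat.Coprimality as Coprime using (1-coprimeTo)
import Data.Integer as ℤ
import Data.Integer.Properties as ℤ
open import Data.Integer using (+_)
open import Data.Rational
  using (ℚ; 0ℚ; 1ℚ; _+_; _-_; _*_; -_; _/_; 1/_; _≤_; _<_; mkℚ; *≤*;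
         NonZero; positive; nonNegative; ≢-nonZero)
open import Data.Rational.Properties
  using (_≟_; _≤?_; _<?_; ↥p/↧p≡p; +-identityˡ; +-inverseʳ; *-assoc; *-identityʳ; *-inverseˡ;
         ≤-reflexive; ≤-trans; <⇒≤; <⇒≢; <-irrefl; <-≤-trans; +-mono-≤; +-monoˡ-≤; +-monoˡ-<;
         +-mono-<-≤; neg-antimono-≤; *-monoˡ-≤-nonNeg; *-monoʳ-≤-nonNeg; *-cancelʳ-≤-pos;
         positive⁻¹; nonNegative⁻¹; pos*pos⇒pos; nonNeg*nonNeg⇒nonNeg; module ≤-Reasoning)
open import Data.Rational.Solver using (module +-*-Solver)
open import Data.Fin.Subset using (Subset; _─_; ∣_∣)
open import Data.List using ([]; _∷_; map; filter; length)
open import Data.List.Membership.Propositional using (_∈_)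
open import Data.List.Relation.Unary.Any using (here; there)
open import Data.Product using (_×_; _,_)
open import Function using (_∘_; _$_)
open import Relation.Binary.PropositionalEquality
open import Relation.Nullary using (¬_; Dec; yes; no; contradiction; ¬?; _×-dec_)
open import Relation.Unary using (Decidable)
open +-*-Solver using (solve; _:=_; con; _:+_; _:*_; _:-_)

-- (+ k) / 1 normalises through a gcd and is stuck for a variable k; the _+_, _*_ and _≤_ of ℚ compute
-- on the mkℚ form with denominator 1.
ℕ→ℚ≡mkℚ : ∀ k → ℕ→ℚ k ≡ mkℚ (+ k) 0 (Coprime.sym (1-coprimeTo k))
ℕ→ℚ≡mkℚ k = ↥p/↧p≡p (mkℚ (+ k) 0 (Coprime.sym (1-coprimeTo k)))

ℕ→ℚ-+ : ∀ a b → ℕ→ℚ (a ℕ.+ b) ≡ ℕ→ℚ a + ℕ→ℚ b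
ℕ→ℚ-+ a b = begin
  (+ a ℤ.+ + b) / 1
    ≡⟨ cong₂ (λ i j → (i ℤ.+ j) / 1) (ℤ.*-identityʳ (+ a)) (ℤ.*-identityʳ (+ b)) ⟨
  (+ a ℤ.* + 1 ℤ.+ + b ℤ.* + 1) / 1
    ≡⟨ cong₂ _+_ (ℕ→ℚ≡mkℚ a) (ℕ→ℚ≡mkℚ b) ⟨
  ℕ→ℚ a + ℕ→ℚ b ∎
  where open ≡-Reasoning

ℕ→ℚ-* : ∀ a b → ℕ→ℚ (a ℕ.* b) ≡ ℕ→ℚ a * ℕ→ℚ b
ℕ→ℚ-* a b = trans (cong (_/ 1) (ℤ.pos-* a b)) (sym (cong₂ _*_ (ℕ→ℚ≡mkℚ a) (ℕ→ℚ≡mkℚ b)))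

ℕ→ℚ-mono-≤ : ∀ {a b} → a ℕ.≤ b → ℕ→ℚ a ≤ ℕ→ℚ b
ℕ→ℚ-mono-≤ {a} {b} a≤b = subst₂ _≤_ (sym (ℕ→ℚ≡mkℚ a)) (sym (ℕ→ℚ≡mkℚ b))
  (*≤* (subst₂ ℤ._≤_ (sym (ℤ.*-identityʳ (+ a))) (sym (ℤ.*-identityʳ (+ b))) (ℤ.+≤+ a≤b)))

0≤ℕ→ℚ : ∀ k → 0ℚ ≤ ℕ→ℚ k
0≤ℕ→ℚ k = ℕ→ℚ-mono-≤ {b = k} z≤n

÷ᵗ-*-cancel : ∀ p {q} → 0ℚ < q → (p ÷ᵗ q) * q ≡ p
÷ᵗ-*-cancel p {q} 0<q with q ≟ 0ℚ
... | yes q≡0 = contradiction (sym q≡0) (<⇒≢ 0<q)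
... | no  q≢0 = begin
  p * (1/ q) * q   ≡⟨ *-assoc p _ q ⟩
  p * (1/ q * q)   ≡⟨ cong (p *_) (*-inverseˡ q) ⟩
  p * 1ℚ           ≡⟨ *-identityʳ p ⟩
  p                ∎
  where
  open ≡-Reasoning
  instance
    q-nonZero : NonZero q
    q-nonZero = ≢-nonZero q≢0

p≤q+p : ∀ {p q} → 0ℚ ≤ q → p ≤ q + p
p≤q+p {p} {q} 0≤q = subst (_≤ q + p) (+-identityˡ p) (+-monoˡ-≤ p 0≤q)

0<1+p : ∀ {p} → 0ℚ ≤ p → 0ℚ < 1ℚ + p
0<1+p 0≤p = +-mono-<-≤ (positive⁻¹ 1ℚ) 0≤p

*-pos : ∀ {p q} → 0ℚ < p → 0ℚ < q → 0ℚ < p * q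
*-pos {p} {q} 0<p 0<q = positive⁻¹ (p * q) {{pos*pos⇒pos p {{positive 0<p}} q {{positive 0<q}}}}

*-nonNeg : ∀ {p q} → 0ℚ ≤ p → 0ℚ ≤ q → 0ℚ ≤ p * q
*-nonNeg {p} {q} 0≤p 0≤q =
  nonNegative⁻¹ (p * q) {{nonNeg*nonNeg⇒nonNeg p {{nonNegative 0≤p}} q {{nonNegative 0≤q}}}}

p≤q+1⇒p-1≤q : ∀ {p q} → p ≤ q + 1ℚ → p - 1ℚ ≤ q
p≤q+1⇒p-1≤q {p} {q} p≤q+1 = begin
  p - 1ℚ          ≤⟨ +-monoˡ-≤ (- 1ℚ) p≤q+1 ⟩
  q + 1ℚ - 1ℚ     ≡⟨ solve 1 (λ q → q :+ con 1ℚ :- con 1ℚ := q) refl q ⟩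
  q               ∎
  where open ≤-Reasoning

module _ {A : Set} {P₁ P₂ : A → Set} (P₁? : Decidable P₁) (P₂? : Decidable P₂) (w : A → ℕ)
         {c₁ c₂ : ℚ} where

  private
    count-step : ∀ i₁ i₂ x xs →
      c₁ * ℕ→ℚ i₁ + c₂ * ℕ→ℚ i₂ ≤ ℕ→ℚ (w x) →
      c₁ * ℕ→ℚ (length (filter P₁? xs)) + c₂ * ℕ→ℚ (length (filter P₂? xs)) ≤ ℕ→ℚ (sum (map w xs)) →
      c₁ * ℕ→ℚ (i₁ ℕ.+ length (filter P₁? xs)) + c₂ * ℕ→ℚ (i₂ ℕ.+ length (filter P₂? xs))
        ≤ ℕ→ℚ (w x ℕ.+ sum (map w xs))
    count-step i₁ i₂ x xs head tail = begin
      c₁ * ℕ→ℚ (i₁ ℕ.+ k₁) + c₂ * ℕ→ℚ (i₂ ℕ.+ k₂)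
        ≡⟨ cong₂ (λ a b → c₁ * a + c₂ * b) (ℕ→ℚ-+ i₁ k₁) (ℕ→ℚ-+ i₂ k₂) ⟩
      c₁ * (ℕ→ℚ i₁ + ℕ→ℚ k₁) + c₂ * (ℕ→ℚ i₂ + ℕ→ℚ k₂)
        ≡⟨ solve 6 (λ c₁ c₂ a₁ b₁ a₂ b₂ → c₁ :* (a₁ :+ b₁) :+ c₂ :* (a₂ :+ b₂)
                                        := (c₁ :* a₁ :+ c₂ :* a₂) :+ (c₁ :* b₁ :+ c₂ :* b₂))
                   refl c₁ c₂ (ℕ→ℚ i₁) (ℕ→ℚ k₁) (ℕ→ℚ i₂) (ℕ→ℚ k₂) ⟩
      (c₁ * ℕ→ℚ i₁ + c₂ * ℕ→ℚ i₂) + (c₁ * ℕ→ℚ k₁ + c₂ * ℕ→ℚ k₂)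
        ≤⟨ +-mono-≤ head tail ⟩
      ℕ→ℚ (w x) + ℕ→ℚ (sum (map w xs))
        ≡⟨ ℕ→ℚ-+ (w x) (sum (map w xs)) ⟨
      ℕ→ℚ (w x ℕ.+ sum (map w xs)) ∎
      where
      open ≤-Reasoning
      k₁ k₂ : ℕ
      k₁ = length (filter P₁? xs)
      k₂ = length (filter P₂? xs)

    one-zero : c₁ * 1ℚ + c₂ * 0ℚ ≡ c₁
    one-zero = solve 2 (λ c₁ c₂ → c₁ :* con 1ℚ :+ c₂ :* con 0ℚ := c₁) refl c₁ c₂

    zero-one : c₁ * 0ℚ + c₂ * 1ℚ ≡ c₂
    zero-one = solve 2 (λ c₁ c₂ → c₁ :* con 0ℚ :+ c₂ :* con 1ℚ := c₂) refl c₁ c₂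

    zero-zero : c₁ * 0ℚ + c₂ * 0ℚ ≡ 0ℚ
    zero-zero = solve 2 (λ c₁ c₂ → c₁ :* con 0ℚ :+ c₂ :* con 0ℚ := con 0ℚ) refl c₁ c₂

  weighted-count : (∀ {x} → P₁ x → ¬ P₂ x) → ∀ xs →
    (∀ {x} → x ∈ xs → P₁ x → c₁ ≤ ℕ→ℚ (w x)) →
    (∀ {x} → x ∈ xs → P₂ x → c₂ ≤ ℕ→ℚ (w x)) →
    c₁ * ℕ→ℚ (length (filter P₁? xs)) + c₂ * ℕ→ℚ (length (filter P₂? xs)) ≤ ℕ→ℚ (sum (map w xs))
  weighted-count disjoint [] _ _ = ≤-reflexive zero-zero
  weighted-count disjoint (x ∷ xs) c₁≤w c₂≤w with P₁? x | P₂? x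
  ... | yes p₁ | yes p₂ = contradiction p₂ (disjoint p₁)
  ... | yes p₁ | no  _  = count-step 1 0 x xs
    (subst (_≤ ℕ→ℚ (w x)) (sym one-zero) (c₁≤w (here refl) p₁))
    (weighted-count disjoint xs (c₁≤w ∘ there) (c₂≤w ∘ there))
  ... | no  _  | yes p₂ = count-step 0 1 x xs
    (subst (_≤ ℕ→ℚ (w x)) (sym zero-one) (c₂≤w (here refl) p₂))
    (weighted-count disjoint xs (c₁≤w ∘ there) (c₂≤w ∘ there))
  ... | no  _  | no  _  = count-step 0 0 x xs
    (subst (_≤ ℕ→ℚ (w x)) (sym zero-zero) (0≤ℕ→ℚ (w x)))
    (weighted-count disjoint xs (c₁≤w ∘ there) (c₂≤w ∘ there))

large-excess-bound : ∀ {α₁ α₂ r w} → 0ℚ ≤ α₁ → 0ℚ ≤ α₂ →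
  (1ℚ + α₁) * r ≤ w + 1ℚ → (1ℚ + α₁) * (r - 1ℚ - α₂) ≤ w
large-excess-bound {α₁} {α₂} {r} {w} 0≤α₁ 0≤α₂ large = begin
  (1ℚ + α₁) * (r - 1ℚ - α₂)
    ≤⟨ p≤q+p (+-mono-≤ (+-mono-≤ 0≤α₁ 0≤α₂) (*-nonNeg 0≤α₁ 0≤α₂)) ⟩
  (α₁ + α₂ + α₁ * α₂) + (1ℚ + α₁) * (r - 1ℚ - α₂)
    ≡⟨ solve 3 (λ α₁ α₂ r → (α₁ :+ α₂ :+ α₁ :* α₂) :+ (con 1ℚ :+ α₁) :* (r :- con 1ℚ :- α₂)
                           := (con 1ℚ :+ α₁) :* r :- con 1ℚ) refl α₁ α₂ r ⟩
  (1ℚ + α₁) * r - 1ℚ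
    ≤⟨ p≤q+1⇒p-1≤q large ⟩
  w ∎
  where open ≤-Reasoning

0<r-1-α₂ : ∀ {r α₂} → 1ℚ + α₂ < r → 0ℚ < r - 1ℚ - α₂
0<r-1-α₂ {r} {α₂} 1+α₂<r = begin-strict
  0ℚ                        ≡⟨ +-inverseʳ (1ℚ + α₂) ⟨
  (1ℚ + α₂) - (1ℚ + α₂)     <⟨ +-monoˡ-< (- (1ℚ + α₂)) 1+α₂<r ⟩
  r - (1ℚ + α₂)             ≡⟨ solve 2 (λ r α₂ → r :- (con 1ℚ :+ α₂) := r :- con 1ℚ :- α₂) refl r α₂ ⟩
  r - 1ℚ - α₂               ∎
  where open ≤-Reasoning

-- In the next three lemmas x, y, z, t, k stand for m₂/(1+α₂), r/(1+α₂), (1+α₂)n/(r-1-α₂),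
-- (1+α₂)(1+α₂r)/(r-1-α₂) and n/α₁; each is specified by the equation clearing its denominator.
neighbour-count-bound : ∀ α₁ α₂ r n m₁ m₂ x y z → 0ℚ < 1ℚ + α₂ → 0ℚ < r - 1ℚ - α₂ →
  x * (1ℚ + α₂) ≡ m₂ → y * (1ℚ + α₂) ≡ r → z * (r - 1ℚ - α₂) ≡ (1ℚ + α₂) * n →
  (1ℚ + α₁) * (r - 1ℚ - α₂) * m₁ + (y - 1ℚ) * m₂ ≤ r * n →
  (1ℚ + α₁) * m₁ + x ≤ n + z
neighbour-count-bound α₁ α₂ r n m₁ m₂ x y z 0<b 0<d x*b≡m₂ y*b≡r z*d≡b*n excess≤ =
  *-cancelʳ-≤-pos ((1ℚ + α₂) * (r - 1ℚ - α₂)) {{positive (*-pos 0<b 0<d)}} $ begin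
    ((1ℚ + α₁) * m₁ + x) * ((1ℚ + α₂) * (r - 1ℚ - α₂))
      ≡⟨ solve 5 (λ α₁ α₂ r m₁ x →
           ((con 1ℚ :+ α₁) :* m₁ :+ x) :* ((con 1ℚ :+ α₂) :* (r :- con 1ℚ :- α₂))
           := (con 1ℚ :+ α₂) :* ((con 1ℚ :+ α₁) :* (r :- con 1ℚ :- α₂) :* m₁)
              :+ x :* (con 1ℚ :+ α₂) :* (r :- con 1ℚ :- α₂)) refl α₁ α₂ r m₁ x ⟩
    (1ℚ + α₂) * ((1ℚ + α₁) * (r - 1ℚ - α₂) * m₁) + x * (1ℚ + α₂) * (r - 1ℚ - α₂)
      ≡⟨ cong (λ t → (1ℚ + α₂) * ((1ℚ + α₁) * (r - 1ℚ - α₂) * m₁) + t * (r - 1ℚ - α₂)) x*b≡m₂ ⟩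
    (1ℚ + α₂) * ((1ℚ + α₁) * (r - 1ℚ - α₂) * m₁) + m₂ * (r - 1ℚ - α₂)
      ≡⟨ cong (λ t → (1ℚ + α₂) * ((1ℚ + α₁) * (r - 1ℚ - α₂) * m₁) + m₂ * (t - 1ℚ - α₂)) (sym y*b≡r) ⟩
    (1ℚ + α₂) * ((1ℚ + α₁) * (r - 1ℚ - α₂) * m₁) + m₂ * (y * (1ℚ + α₂) - 1ℚ - α₂)
      ≡⟨ solve 6 (λ α₁ α₂ r m₁ m₂ y →
           (con 1ℚ :+ α₂) :* ((con 1ℚ :+ α₁) :* (r :- con 1ℚ :- α₂) :* m₁)
             :+ m₂ :* (y :* (con 1ℚ :+ α₂) :- con 1ℚ :- α₂)
           := (con 1ℚ :+ α₂) :* ((con 1ℚ :+ α₁) :* (r :- con 1ℚ :- α₂) :* m₁ :+ (y :- con 1ℚ) :* m₂))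
           refl α₁ α₂ r m₁ m₂ y ⟩
    (1ℚ + α₂) * ((1ℚ + α₁) * (r - 1ℚ - α₂) * m₁ + (y - 1ℚ) * m₂)
      ≤⟨ *-monoˡ-≤-nonNeg (1ℚ + α₂) {{nonNegative (<⇒≤ 0<b)}} excess≤ ⟩
    (1ℚ + α₂) * (r * n)
      ≡⟨ solve 3 (λ α₂ r n → (con 1ℚ :+ α₂) :* (r :* n)
                            := (n :* (r :- con 1ℚ :- α₂) :+ (con 1ℚ :+ α₂) :* n) :* (con 1ℚ :+ α₂))
                 refl α₂ r n ⟩
    (n * (r - 1ℚ - α₂) + (1ℚ + α₂) * n) * (1ℚ + α₂)
      ≡⟨ cong (λ t → (n * (r - 1ℚ - α₂) + t) * (1ℚ + α₂)) (sym z*d≡b*n) ⟩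
    (n * (r - 1ℚ - α₂) + z * (r - 1ℚ - α₂)) * (1ℚ + α₂)
      ≡⟨ solve 4 (λ α₂ r n z → (n :* (r :- con 1ℚ :- α₂) :+ z :* (r :- con 1ℚ :- α₂)) :* (con 1ℚ :+ α₂)
                              := (n :+ z) :* ((con 1ℚ :+ α₂) :* (r :- con 1ℚ :- α₂)))
                 refl α₂ r n z ⟩
    (n + z) * ((1ℚ + α₂) * (r - 1ℚ - α₂)) ∎
  where open ≤-Reasoning

scaled-large-count-bound : ∀ α₁ α₂ τ n m₁ m₂ x z → 0ℚ ≤ α₁ → 0ℚ ≤ α₂ → 0ℚ ≤ m₁ →
  x * (1ℚ + α₂) ≡ m₂ → (1ℚ + α₁) * m₁ + x ≤ n + z → (1ℚ - τ) * n ≤ m₁ + m₂ →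
  α₁ * m₁ ≤ τ * n + α₂ * n + (1ℚ + α₂) * z
scaled-large-count-bound α₁ α₂ τ n m₁ m₂ x z 0≤α₁ 0≤α₂ 0≤m₁ x*b≡m₂ count≤ coverage =
  begin
    α₁ * m₁
      ≡⟨ solve 4 (λ α₁ α₂ m₁ x → α₁ :* m₁
                                := ((con 1ℚ :+ α₁) :* m₁ :+ x) :- (m₁ :+ x :* (con 1ℚ :+ α₂)) :+ α₂ :* x)
                 refl α₁ α₂ m₁ x ⟩
    ((1ℚ + α₁) * m₁ + x) - (m₁ + x * (1ℚ + α₂)) + α₂ * x
      ≡⟨ cong (λ t → ((1ℚ + α₁) * m₁ + x) - (m₁ + t) + α₂ * x) x*b≡m₂ ⟩
    ((1ℚ + α₁) * m₁ + x) - (m₁ + m₂) + α₂ * x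
      ≤⟨ +-mono-≤ (+-mono-≤ count≤ (neg-antimono-≤ coverage))
                  (*-monoˡ-≤-nonNeg α₂ {{nonNegative 0≤α₂}} x≤n+z) ⟩
    (n + z) - (1ℚ - τ) * n + α₂ * (n + z)
      ≡⟨ solve 4 (λ α₂ τ n z → (n :+ z) :- (con 1ℚ :- τ) :* n :+ α₂ :* (n :+ z)
                              := τ :* n :+ α₂ :* n :+ (con 1ℚ :+ α₂) :* z)
                 refl α₂ τ n z ⟩
    τ * n + α₂ * n + (1ℚ + α₂) * z ∎
  where
  open ≤-Reasoning
  x≤n+z : x ≤ n + z
  x≤n+z = ≤-trans (p≤q+p (*-nonNeg (<⇒≤ (0<1+p 0≤α₁)) 0≤m₁)) count≤

large-count-bound : ∀ α₁ α₂ τ r n m₁ z t k → 0ℚ < α₁ → 0ℚ ≤ α₂ → 0ℚ ≤ r → 0ℚ ≤ n →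
  0ℚ < r - 1ℚ - α₂ → z * (r - 1ℚ - α₂) ≡ (1ℚ + α₂) * n →
  t * (r - 1ℚ - α₂) ≡ (1ℚ + α₂) * (1ℚ + α₂ * r) → k * α₁ ≡ n →
  α₁ * m₁ ≤ τ * n + α₂ * n + (1ℚ + α₂) * z → m₁ ≤ (τ + t) * k
large-count-bound α₁ α₂ τ r n m₁ z t k 0<α₁ 0≤α₂ 0≤r 0≤n 0<d z*d≡b*n t*d≡c k*α₁≡n α₁m₁≤ =
  *-cancelʳ-≤-pos (α₁ * (r - 1ℚ - α₂)) {{positive (*-pos 0<α₁ 0<d)}} $ begin
    m₁ * (α₁ * (r - 1ℚ - α₂))
      ≡⟨ solve 4 (λ α₁ α₂ r m₁ → m₁ :* (α₁ :* (r :- con 1ℚ :- α₂))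
                                := (α₁ :* m₁) :* (r :- con 1ℚ :- α₂))
                 refl α₁ α₂ r m₁ ⟩
    (α₁ * m₁) * (r - 1ℚ - α₂)
      ≤⟨ *-monoʳ-≤-nonNeg (r - 1ℚ - α₂) {{nonNegative (<⇒≤ 0<d)}} α₁m₁≤ ⟩
    (τ * n + α₂ * n + (1ℚ + α₂) * z) * (r - 1ℚ - α₂)
      ≡⟨ solve 5 (λ α₂ τ r n z → (τ :* n :+ α₂ :* n :+ (con 1ℚ :+ α₂) :* z) :* (r :- con 1ℚ :- α₂)
                                := (τ :* n :+ α₂ :* n) :* (r :- con 1ℚ :- α₂)
                                   :+ (con 1ℚ :+ α₂) :* (z :* (r :- con 1ℚ :- α₂)))
                 refl α₂ τ r n z ⟩
    (τ * n + α₂ * n) * (r - 1ℚ - α₂) + (1ℚ + α₂) * (z * (r - 1ℚ - α₂))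
      ≡⟨ cong (λ u → (τ * n + α₂ * n) * (r - 1ℚ - α₂) + (1ℚ + α₂) * u) z*d≡b*n ⟩
    (τ * n + α₂ * n) * (r - 1ℚ - α₂) + (1ℚ + α₂) * ((1ℚ + α₂) * n)
      ≤⟨ p≤q+p (*-nonNeg (*-nonNeg (*-nonNeg 0≤α₂ 0≤α₂) 0≤r) 0≤n) ⟩
    α₂ * α₂ * r * n + ((τ * n + α₂ * n) * (r - 1ℚ - α₂) + (1ℚ + α₂) * ((1ℚ + α₂) * n))
      ≡⟨ solve 4 (λ α₂ τ r n → α₂ :* α₂ :* r :* n
                                 :+ ((τ :* n :+ α₂ :* n) :* (r :- con 1ℚ :- α₂)
                                     :+ (con 1ℚ :+ α₂) :* ((con 1ℚ :+ α₂) :* n))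
                              := τ :* n :* (r :- con 1ℚ :- α₂)
                                   :+ (con 1ℚ :+ α₂) :* (con 1ℚ :+ α₂ :* r) :* n)
                 refl α₂ τ r n ⟩
    τ * n * (r - 1ℚ - α₂) + (1ℚ + α₂) * (1ℚ + α₂ * r) * n
      ≡⟨ cong₂ (λ u v → τ * u * (r - 1ℚ - α₂) + v * u) (sym k*α₁≡n) (sym t*d≡c) ⟩
    τ * (k * α₁) * (r - 1ℚ - α₂) + t * (r - 1ℚ - α₂) * (k * α₁)
      ≡⟨ solve 6 (λ α₁ α₂ τ r t k → τ :* (k :* α₁) :* (r :- con 1ℚ :- α₂)
                                     :+ t :* (r :- con 1ℚ :- α₂) :* (k :* α₁)
                                  := (τ :+ t) :* k :* (α₁ :* (r :- con 1ℚ :- α₂)))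
                 refl α₁ α₂ τ r t k ⟩
    (τ + t) * k * (α₁ * (r - 1ℚ - α₂)) ∎
  where open ≤-Reasoning

open LinearHypergraph using (∣f∣≡∣f─e∣+1; sum-excess≤∣e∣*n)

large? : ∀ {n} (α₁ : ℚ) (e f : Subset n) → Dec ((1ℚ + α₁) * sz e ≤ sz f)
large? α₁ e f = ((1ℚ + α₁) * sz e) ≤? sz f

medium? : ∀ {n} (α₁ α₂ : ℚ) (e f : Subset n) →
  Dec (sz f < (1ℚ + α₁) * sz e × sz e ÷ᵗ (1ℚ + α₂) ≤ sz f)
medium? α₁ α₂ e f = (sz f <? ((1ℚ + α₁) * sz e)) ×-dec ((sz e ÷ᵗ (1ℚ + α₂)) ≤? sz f)

excess-count-bound : ∀ {n} (H : Hypergraph n) → Linear H → ∀ {e} → e ∈ edges H →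
  ∀ {α₁ α₂} → 0ℚ ≤ α₁ → 0ℚ ≤ α₂ →
  (1ℚ + α₁) * (sz e - 1ℚ - α₂) * ℕ→ℚ (length (filter (large? α₁ e) (N H e)))
    + (sz e ÷ᵗ (1ℚ + α₂) - 1ℚ) * ℕ→ℚ (length (filter (medium? α₁ α₂ e) (N H e)))
    ≤ sz e * ℕ→ℚ n
excess-count-bound {n} H linear {e} e∈H {α₁} {α₂} 0≤α₁ 0≤α₂ = begin
  (1ℚ + α₁) * (sz e - 1ℚ - α₂) * ℕ→ℚ (length (filter (large? α₁ e) (N H e)))
    + (sz e ÷ᵗ (1ℚ + α₂) - 1ℚ) * ℕ→ℚ (length (filter (medium? α₁ α₂ e) (N H e)))
    ≤⟨ weighted-count (large? α₁ e) (medium? α₁ α₂ e) (λ f → ∣ f ─ e ∣) (λ {f} → disjoint {f}) (N H e)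
                      large-excess medium-excess ⟩
  ℕ→ℚ (sum (map (λ f → ∣ f ─ e ∣) (N H e)))
    ≤⟨ ℕ→ℚ-mono-≤ (sum-excess≤∣e∣*n H linear e∈H) ⟩
  ℕ→ℚ (∣ e ∣ ℕ.* n)
    ≡⟨ ℕ→ℚ-* ∣ e ∣ n ⟩
  sz e * ℕ→ℚ n ∎
  where
  open ≤-Reasoning
  disjoint : ∀ {f} → (1ℚ + α₁) * sz e ≤ sz f → ¬ (sz f < (1ℚ + α₁) * sz e × sz e ÷ᵗ (1ℚ + α₂) ≤ sz f)
  disjoint large (smaller , _) = <-irrefl refl (<-≤-trans smaller large)
  sz≡excess+1 : ∀ {f} → f ∈ N H e → sz f ≡ ℕ→ℚ ∣ f ─ e ∣ + 1ℚ
  sz≡excess+1 {f} f∈N = trans (cong ℕ→ℚ (∣f∣≡∣f─e∣+1 H linear e∈H f∈N)) (ℕ→ℚ-+ ∣ f ─ e ∣ 1)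
  large-excess : ∀ {f} → f ∈ N H e → (1ℚ + α₁) * sz e ≤ sz f →
    (1ℚ + α₁) * (sz e - 1ℚ - α₂) ≤ ℕ→ℚ ∣ f ─ e ∣
  large-excess f∈N large =
    large-excess-bound 0≤α₁ 0≤α₂ (subst ((1ℚ + α₁) * sz e ≤_) (sz≡excess+1 f∈N) large)
  medium-excess : ∀ {f} → f ∈ N H e → sz f < (1ℚ + α₁) * sz e × sz e ÷ᵗ (1ℚ + α₂) ≤ sz f →
    sz e ÷ᵗ (1ℚ + α₂) - 1ℚ ≤ ℕ→ℚ ∣ f ─ e ∣
  medium-excess f∈N (_ , medium) =
    p≤q+1⇒p-1≤q (subst (sz e ÷ᵗ (1ℚ + α₂) ≤_) (sz≡excess+1 f∈N) medium)

proposition6p3 : (α₁ α₂ τ : ℚ) → 0ℚ ≤ α₁ → 0ℚ ≤ α₂ → 0ℚ ≤ τ →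
    (n : ℕ) (H : Hypergraph n) → Linear H →
    (∀ {f} → f ∈ edges H → 1ℚ + α₂ ≤ sz f) →
    (e : Subset n) → e ∈ edges H →
    let r  = sz e
        m₁ = ℕ→ℚ (length (filter (λ f → ((1ℚ + α₁) * r) ≤? sz f) (N H e)))
        m₂ = ℕ→ℚ (length (filter (λ f → (sz f <? ((1ℚ + α₁) * r)) ×-dec ((r ÷ᵗ (1ℚ + α₂)) ≤? sz f)) (N H e)))
        nq = ℕ→ℚ n
    in 1ℚ + α₂ < r →
       ((1ℚ + α₁) * m₁ + (m₂ ÷ᵗ (1ℚ + α₂)) ≤ nq + (((1ℚ + α₂) * nq) ÷ᵗ (r - 1ℚ - α₂)))
       × ((1ℚ - τ) * nq ≤ m₁ + m₂ → 0ℚ < α₁ →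
          m₁ ≤ (τ + (((1ℚ + α₂) * (1ℚ + α₂ * r)) ÷ᵗ (r - 1ℚ - α₂))) * (nq ÷ᵗ α₁))
proposition6p3 α₁ α₂ τ 0≤α₁ 0≤α₂ _ n H linear _ e e∈H 1+α₂<r = part-i , part-ii
  where
  k₁ : ℕ
  k₁ = length (filter (large? α₁ e) (N H e))

  r nq m₁ m₂ x z t : ℚ
  r  = sz e
  nq = ℕ→ℚ n
  m₁ = ℕ→ℚ k₁
  m₂ = ℕ→ℚ (length (filter (medium? α₁ α₂ e) (N H e)))
  x  = m₂ ÷ᵗ (1ℚ + α₂)
  z  = ((1ℚ + α₂) * nq) ÷ᵗ (r - 1ℚ - α₂)
  t  = ((1ℚ + α₂) * (1ℚ + α₂ * r)) ÷ᵗ (r - 1ℚ - α₂)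

  0<b : 0ℚ < 1ℚ + α₂
  0<b = 0<1+p 0≤α₂

  0<d : 0ℚ < r - 1ℚ - α₂
  0<d = 0<r-1-α₂ 1+α₂<r

  part-i : (1ℚ + α₁) * m₁ + x ≤ nq + z
  part-i = neighbour-count-bound α₁ α₂ r nq m₁ m₂ x (r ÷ᵗ (1ℚ + α₂)) z 0<b 0<d
    (÷ᵗ-*-cancel m₂ 0<b) (÷ᵗ-*-cancel r 0<b) (÷ᵗ-*-cancel _ 0<d)
    (excess-count-bound H linear e∈H 0≤α₁ 0≤α₂)

  part-ii : (1ℚ - τ) * nq ≤ m₁ + m₂ → 0ℚ < α₁ → m₁ ≤ (τ + t) * (nq ÷ᵗ α₁)
  part-ii coverage 0<α₁ =
    large-count-bound α₁ α₂ τ r nq m₁ z t (nq ÷ᵗ α₁) 0<α₁ 0≤α₂ (0≤ℕ→ℚ ∣ e ∣) (0≤ℕ→ℚ n) 0<d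
      (÷ᵗ-*-cancel _ 0<d) (÷ᵗ-*-cancel _ 0<d) (÷ᵗ-*-cancel nq 0<α₁)
      (scaled-large-count-bound α₁ α₂ τ nq m₁ m₂ x z 0≤α₁ 0≤α₂ (0≤ℕ→ℚ k₁) (÷ᵗ-*-cancel m₂ 0<b)
                                part-i coverage)
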